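{- Let $r\ge1$, $p\ge2$, $\bm{x}_i=(x_{i1},\ldots,x_{ip})\in\mathbb{C}^p$ for $1\le i\le r$, and $t_1,\ldots,t_{p-1}\in\mathbb{C}\setminus\{0,-1,-2,\ldots\}$. Then for any $n_1,\ldots,n_r\in\mathbb{N}$, $$(n_1+\cdots+n_r+t_1)\,c^{t_1,\ldots,t_{p-1}}_{\bm{x}_1;\cdots;\bm{x}_r}(n_1,\ldots,n_r)-\sum_{k=1}^r x_{k1}n_k\,c^{t_1,\ldots,t_{p-1}}_{\bm{x}_1;\cdots;\bm{x}_r}(n_1,\ldots,n_k-1,\ldots,n_r)=c^{t_2,\ldots,t_{p-1}}_{{}^{ - }\bm{x}_1;\cdots;{}^{ - }\bm{x}_r}(n_1,\ldots,n_r),$$ where a term with $n_k=0$ in the sum is zero, and ${}^{ - }\bm{x}=(x_2,\ldots,x_p)$ for $\bm{x}=(x_1,\ldots,x_p)$.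
   Context: $\mathbb{N}=\{0,1,2,\ldots\}$; $0^0=1$. For complex $z$ and $m\in\mathbb{N}$, $\binom{z}{m}=z(z-1)\cdots(z-m+1)/m!$; multinomial coefficients are $\binom{n}{\nu_1,\ldots,\nu_p}=n!/(\nu_1!\cdots\nu_p!)$. For $p\ge1$, $\bm{x}_i=(x_{i1},\ldots,x_{ip})\in\mathbb{C}^p$ ($1\le i\le r$), $t_1,\ldots,t_{p-1}\in\mathbb{C}\setminus\{0,-1,-2,\ldots\}$ and $n_1,\ldots,n_r\in\mathbb{N}$, define $$c^{t_1,\ldots,t_{p-1}}_{\bm{x}_1;\cdots;\bm{x}_r}(n_1,\ldots,n_r)=\sum\frac{\prod_{i=1}^r\binom{n_i}{\nu_{i1},\ldots,\nu_{ip}}x_{i1}^{\nu_{i1}}\cdots x_{ip}^{\nu_{ip}}}{\prod_{j=1}^{p-1}\binom{n_{1j}+\cdots+n_{rj}+t_j-1}{\nu_{1j}+\cdots+\nu_{rj}}(n_{1j}+\cdots+n_{rj}+t_j)},$$ where the sum runs over all integers $n_{ij}$ ($1\le i\le r$, $1\le j\le p$) with $n_i=n_{i1}\ge n_{i2}\ge\cdots\ge n_{ip}\ge0$ for each $i$, and $\nu_{ij}=n_{ij}-n_{i,j+1}$ for $j<p$, $\nu_{ip}=n_{ip}$. For $p=1$ this is $x_1^{n_1}\cdots x_r^{n_r}$ (with $\bm{x}_i=(x_i)$ and no $t$'s). -}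

module Defs where

open import Level using (Level; _⊔_) renaming (suc to lsuc)
open import Algebra.Bundles using (CommutativeRing)
open import Data.Nat as ℕ using (ℕ; zero; suc; _∸_; _!; NonZero)
open import Data.Nat.Properties using (m*n≢0; _!≢0)
open import Data.Fin using (Fin; zero; suc; inject₁)
open import Data.List using (List; []; _∷_; concatMap; map; upTo)
open import Data.Vec using (Vec; []; _∷_; lookup)
open import Data.Vec.Functional using (Vector; updateAt)
import Data.Vec.Functional as VF
open import Relation.Nullary using (¬_)

prodFact : ∀ {k} → Vec ℕ k → ℕ
prodFact []       = 1
prodFact (v ∷ vs) = v ! ℕ.* prodFact vs

prodFact≢0 : ∀ {k} (vs : Vec ℕ k) → NonZero (prodFact vs)
prodFact≢0 []       = _
prodFact≢0 (v ∷ vs) = m*n≢0 (v !) (prodFact vs) {{v !≢0}} {{prodFact≢0 vs}}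

multinomial : ∀ {k} → ℕ → Vec ℕ k → ℕ
multinomial n νs = ℕ._/_ (n !) (prodFact νs) {{prodFact≢0 νs}}

chains : (q : ℕ) → ℕ → List (Vec ℕ (suc q))
chains zero    n = (n ∷ []) ∷ []
chains (suc q) n = concatMap (λ m → map (n ∷_) (chains q m)) (upTo (suc n))

families : (q r : ℕ) → (Fin r → ℕ) → List (Fin r → Vec ℕ (suc q))
families q zero    n = (λ ()) ∷ []
families q (suc r) n =
  concatMap (λ c → map (λ f → c VF.∷ f) (families q r (VF.tail n))) (chains q (VF.head n))

diffs : ∀ {q} → Vec ℕ (suc q) → Vec ℕ (suc q)
diffs (a ∷ [])     = a ∷ []
diffs (a ∷ b ∷ vs) = (a ∸ b) ∷ diffs (b ∷ vs)

sumℕ : ∀ {r} → (Fin r → ℕ) → ℕ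
sumℕ {zero}  f = 0
sumℕ {suc r} f = f zero ℕ.+ sumℕ (λ i → f (suc i))

-- A field of characteristic zero (stand-in for ℂ); the inverse is a total
-- operation, only specified on nonzero elements.

module _ {c ℓ : Level} (R : CommutativeRing c ℓ) where
  open CommutativeRing R
  fromℕ : ℕ → Carrier
  fromℕ zero    = 0#
  fromℕ (suc n) = 1# + fromℕ n

record CharZeroField (a ℓ : Level) : Set (lsuc (a ⊔ ℓ)) where
  field
    commRing   : CommutativeRing a ℓ
  private module R = CommutativeRing commRing
  field
    _⁻¹        : R.Carrier → R.Carrier
    ⁻¹-inverse : ∀ x → ¬ (x R.≈ R.0#) → x R.* (x ⁻¹) R.≈ R.1#
    1≉0        : ¬ (R.1# R.≈ R.0#)
    charZero   : ∀ n → ¬ (fromℕ commRing (suc n) R.≈ R.0#)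

  open CommutativeRing commRing public hiding (zero)

  ι : ℕ → Carrier
  ι = fromℕ commRing

  _^_ : Carrier → ℕ → Carrier
  x ^ zero  = 1#
  x ^ suc n = x * (x ^ n)

  sumF : ∀ {r} → (Fin r → Carrier) → Carrier
  sumF {zero}  f = 0#
  sumF {suc r} f = f zero + sumF (λ i → f (suc i))

  prodF : ∀ {r} → (Fin r → Carrier) → Carrier
  prodF {zero}  f = 1#
  prodF {suc r} f = f zero * prodF (λ i → f (suc i))

  sumList : List Carrier → Carrier
  sumList []       = 0#
  sumList (a ∷ as) = a + sumList as

  falling : Carrier → ℕ → Carrier
  falling z zero    = 1#
  falling z (suc m) = falling z m * (z - ι m)

  binom : Carrier → ℕ → Carrier
  binom z m = falling z m * (ι (m !) ⁻¹)

  NotNonPosInt : Carrier → Set ℓ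
  NotNonPosInt t = ∀ m → ¬ (t + ι m ≈ 0#)

  -- the summand of c for a family N (N i = (n_{i1},…,n_{ip}), p = q+1)
  cTerm : ∀ q {r} → (Fin q → Carrier) → (Fin r → Fin (suc q) → Carrier)
          → (Fin r → ℕ) → (Fin r → Vec ℕ (suc q)) → Carrier
  cTerm q {r} t x n N = numer * (denom ⁻¹)
    where
    ν : Fin r → Fin (suc q) → ℕ
    ν i j = lookup (diffs (N i)) j
    numer : Carrier
    numer = prodF λ i → ι (multinomial (n i) (diffs (N i)))
                        * prodF (λ j → x i j ^ ν i j)
    S : Fin q → ℕ
    S j = sumℕ λ i → lookup (N i) (inject₁ j)
    V : Fin q → ℕ
    V j = sumℕ λ i → ν i (inject₁ j)
    denom : Carrier
    denom = prodF λ j → binom (ι (S j) + t j - 1#) (V j) * (ι (S j) + t j)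

  c : ∀ q {r} → (Fin q → Carrier) → (Fin r → Fin (suc q) → Carrier)
      → (Fin r → ℕ) → Carrier
  c q t x n = sumList (map (cTerm q t x n) (families q _ n))

  shiftTerm : ∀ q {r} → (Fin q → Carrier) → (Fin r → Fin (suc q) → Carrier)
              → (Fin r → ℕ) → Fin r → Carrier
  shiftTerm q t x n k with n k
  ... | zero  = 0#
  ... | suc m = x k zero * ι (suc m) * c q t x (updateAt n k (λ _ → m))

module Submission where

-- Peeling the first level off every chain gives c^{t₁,…}(n) = Σ_{m ≤ n} A(n,m) c^{t₂,…}(m) with
-- A(n,m) = Πᵢ C(nᵢ,mᵢ) x_{i1}^{nᵢ-mᵢ} / (C(|n|+t₁-1, |n|-|m|) (|n|+t₁)), and the same expansion applies
-- to every shifted term c(n - e_k). The recurrence thus reduces to the coefficient identity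
--   (|n|+t₁) A(n,m) - Σ_k x_{k1} n_k A(n-e_k, m) = [m = n].
-- For m = n the shifted coefficients vanish (C(nₖ-1, nₖ) = 0) and A(n,n) = 1/(|n|+t₁). For m < n the
-- absorption identities n C(n-1,m) = (n-m) C(n,m) and V C(u,V) = u C(u-1,V-1) turn both terms into
-- |n-m| Πᵢ C(nᵢ,mᵢ) x_{i1}^{nᵢ-mᵢ} / (C(|n|+t₁-2, |n|-|m|-1) (|n|+t₁-1)).

open import Defs
open import Level using (Level)
open import Algebra.Bundles using (CommutativeRing)
open import Data.Nat using (ℕ; suc; _≤_)
open import Data.Fin using (Fin; zero)
open import Data.Vec.Functional using (tail)

open import Data.Nat as ℕ using (zero; _<_; _!)
open import Data.Nat.Properties as ℕP using (_!*_!≢0)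
open import Data.Nat.Combinatorics using (_C_; nCk≡n!/k![n-k]!; k![n∸k]!∣n!; nCn≡1; k>n⇒nCk≡0)
open import Data.Nat.DivMod using (m*n/n≡m; m/n*n≡m; /-congˡ)
open import Data.Nat.Divisibility using (_∣_; divides; ∣-trans; *-monoʳ-∣)
open import Data.Nat.Solver using (module +-*-Solver)
open import Data.Fin using (suc; inject₁)
import Data.Fin.Properties as FinP
open import Data.Vec using (Vec; []; _∷_; lookup)
import Data.Vec.Functional as VF
open import Data.Vec.Functional using (updateAt)
open import Data.Vec.Functional.Properties using (updateAt-updates; updateAt-minimal)
open import Data.List using (List; []; _∷_; _++_; [_]; concatMap; map; upTo)
open import Data.List.Properties using (upTo-∷ʳ)
open import Data.List.Membership.Propositional using (_∈_; find)
open import Data.List.Membership.Propositional.Properties using (∈-map⁻; ∈-concatMap⁻; ∈-upTo⁻)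
open import Data.List.Relation.Unary.Any using (here; there)
open import Data.Product using (∃₂; _×_; _,_)
open import Relation.Binary.PropositionalEquality as P using (_≡_; _≗_)
open import Relation.Binary.Core using (_Preserves_⟶_)
open import Function using (_∘_)
open import Relation.Nullary using (¬_; yes; no)
open import Data.Vec.Functional.Relation.Binary.Pointwise using (Pointwise)

private
  variable
    q r : ℕ

module _ where
  open import Data.Nat using (_*_; _∸_; _/_)
  open P
  open ≡-Reasoning
  open +-*-Solver using (solve; _:=_; _:*_)

  C-factorial : ∀ {n k} → k ≤ n → (n C k) * (k ! * (n ∸ k) !) ≡ n !
  C-factorial {n} {k} k≤n = begin
    (n C k) * (k ! * (n ∸ k) !)                    ≡⟨ cong (_* (k ! * (n ∸ k) !)) (nCk≡n!/k![n-k]! k≤n) ⟩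
    n ! / (k ! * (n ∸ k) !) * (k ! * (n ∸ k) !)    ≡⟨ m/n*n≡m (k![n∸k]!∣n! k≤n) ⟩
    n !                                            ∎
    where instance _ = k !* (n ∸ k) !≢0

  C-absorb : ∀ {n m} → m ≤ n → suc n * (n C m) ≡ suc (n ∸ m) * (suc n C m)
  C-absorb {n} {m} m≤n = ℕP.*-cancelʳ-≡ _ _ (m ! * (n ∸ m) !) (begin
    suc n * (n C m) * (m ! * (n ∸ m) !)            ≡⟨ ℕP.*-assoc (suc n) (n C m) _ ⟩
    suc n * ((n C m) * (m ! * (n ∸ m) !))          ≡⟨ cong (suc n *_) (C-factorial m≤n) ⟩
    suc n !                                        ≡⟨ C-factorial (ℕP.m≤n⇒m≤1+n m≤n) ⟨
    (suc n C m) * (m ! * (suc n ∸ m) !)            ≡⟨ cong (λ z → (suc n C m) * (m ! * z !)) (ℕP.+-∸-assoc 1 m≤n) ⟩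
    (suc n C m) * (m ! * (suc (n ∸ m) * (n ∸ m) !))
      ≡⟨ solve 4 (λ c a s b → c :* (a :* (s :* b)) := s :* c :* (a :* b)) refl (suc n C m) (m !) (suc (n ∸ m)) ((n ∸ m) !) ⟩
    suc (n ∸ m) * (suc n C m) * (m ! * (n ∸ m) !)  ∎)
    where instance _ = m !* (n ∸ m) !≢0

  multinomial-∷ : ∀ {k n m} (d : Vec ℕ k) → m ≤ n → prodFact d ∣ m ! →
                  multinomial n ((n ∸ m) ∷ d) ≡ (n C m) * multinomial m d
  multinomial-∷ {n = n} {m} d m≤n d∣m! = begin
    n ! / ((n ∸ m) ! * prodFact d)                                 ≡⟨ /-congˡ n!≡ ⟩
    (n C m) * multinomial m d * ((n ∸ m) ! * prodFact d) / ((n ∸ m) ! * prodFact d)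
      ≡⟨ m*n/n≡m ((n C m) * multinomial m d) ((n ∸ m) ! * prodFact d) ⟩
    (n C m) * multinomial m d                                      ∎
    where
    instance
      _ = prodFact≢0 d
      _ = prodFact≢0 ((n ∸ m) ∷ d)
    n!≡ : n ! ≡ (n C m) * multinomial m d * ((n ∸ m) ! * prodFact d)
    n!≡ = begin
      n !                                                  ≡⟨ C-factorial m≤n ⟨
      (n C m) * (m ! * (n ∸ m) !)                          ≡⟨ cong (λ z → (n C m) * (z * (n ∸ m) !)) (m/n*n≡m d∣m!) ⟨
      (n C m) * (multinomial m d * prodFact d * (n ∸ m) !)
        ≡⟨ solve 4 (λ c u p f → c :* (u :* p :* f) := c :* u :* (f :* p)) refl
                   (n C m) (multinomial m d) (prodFact d) ((n ∸ m) !) ⟩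
      (n C m) * multinomial m d * ((n ∸ m) ! * prodFact d) ∎

data Chain : ∀ {q} → ℕ → Vec ℕ (suc q) → Set where
  end  : ∀ {a} → Chain a (a ∷ [])
  step : ∀ {q a b} {v : Vec ℕ (suc q)} → b ≤ a → Chain b v → Chain a (a ∷ v)

diffs-∷ : ∀ {a m} {g : Vec ℕ (suc q)} → Chain m g → diffs (a ∷ g) ≡ (a ℕ.∸ m) ∷ diffs g
diffs-∷ end        = P.refl
diffs-∷ (step _ _) = P.refl

lookup-diffs≤lookup : (v : Vec ℕ (suc q)) (j : Fin (suc q)) → lookup (diffs v) j ≤ lookup v j
lookup-diffs≤lookup (a ∷ [])    zero    = ℕP.≤-refl
lookup-diffs≤lookup (a ∷ b ∷ v) zero    = ℕP.m∸n≤m a b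
lookup-diffs≤lookup (a ∷ b ∷ v) (suc j) = lookup-diffs≤lookup (b ∷ v) j

prodFact-diffs∣! : ∀ {a} {v : Vec ℕ (suc q)} → Chain a v → prodFact (diffs v) ∣ a !
prodFact-diffs∣! {a = a} end = divides 1 (P.sym (P.trans (ℕP.*-identityˡ _) (ℕP.*-identityʳ (a !))))
prodFact-diffs∣! {a = a} (step {b = b} b≤a ch) rewrite diffs-∷ {a = a} ch =
  ∣-trans (*-monoʳ-∣ ((a ℕ.∸ b) !) (prodFact-diffs∣! ch))
          (divides (a C b) (P.sym (P.trans (P.cong ((a C b) ℕ.*_) (ℕP.*-comm ((a ℕ.∸ b) !) (b !))) (C-factorial b≤a))))

boxes : (r : ℕ) → (Fin r → ℕ) → List (Fin r → ℕ)
boxes zero    n = (λ ()) ∷ []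
boxes (suc r) n = concatMap (λ a → map (a VF.∷_) (boxes r (tail n))) (upTo (suc (n zero)))

∈-concatMap-map⁻ : ∀ {A B C : Set} {g : A → B → C} {h : A → List B} {xs : List A} {y : C} →
                   y ∈ concatMap (λ a → map (g a) (h a)) xs → ∃₂ λ a b → a ∈ xs × b ∈ h a × y ≡ g a b
∈-concatMap-map⁻ y∈ with find (∈-concatMap⁻ _ y∈)
... | a , a∈xs , y∈map with ∈-map⁻ _ y∈map
... | b , b∈ha , y≡gab = a , b , a∈xs , b∈ha , y≡gab

∈-chains⁻ : ∀ {a} {v : Vec ℕ (suc q)} → v ∈ chains q a → Chain a v
∈-chains⁻ {q = zero} (here P.refl) = end
∈-chains⁻ {q = suc q} {a = a} v∈
  with ∈-concatMap-map⁻ {g = λ _ → a ∷_} {h = chains q} {xs = upTo (suc a)} v∈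
... | b , u , b∈ , u∈ , P.refl = step (ℕP.≤-pred (∈-upTo⁻ b∈)) (∈-chains⁻ u∈)

∈-boxes⁻ : ∀ {n m : Fin r → ℕ} → m ∈ boxes r n → Pointwise _≤_ m n
∈-boxes⁻ {r = suc r} {n = n} m∈ i
  with ∈-concatMap-map⁻ {g = VF._∷_} {h = λ _ → boxes r (tail n)} {xs = upTo (suc (n zero))} m∈
∈-boxes⁻ {r = suc r} m∈ zero    | a , m′ , a∈ , m′∈ , P.refl = ℕP.≤-pred (∈-upTo⁻ a∈)
∈-boxes⁻ {r = suc r} m∈ (suc i) | a , m′ , a∈ , m′∈ , P.refl = ∈-boxes⁻ m′∈ i

∈-families⁻ : ∀ {n : Fin r → ℕ} {N} → N ∈ families q r n → ∀ i → Chain (n i) (N i)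
∈-families⁻ {r = suc r} {q = q} {n = n} N∈ i
  with ∈-concatMap-map⁻ {g = VF._∷_} {h = λ _ → families q r (tail n)} {xs = chains q (n zero)} N∈
∈-families⁻ {r = suc r} N∈ zero    | v , N′ , v∈ , N′∈ , P.refl = ∈-chains⁻ v∈
∈-families⁻ {r = suc r} N∈ (suc i) | v , N′ , v∈ , N′∈ , P.refl = ∈-families⁻ N′∈ i

families-cong : ∀ {n n′ : Fin r → ℕ} → n ≗ n′ → families q r n ≡ families q r n′
families-cong {zero}  eq = P.refl
families-cong {suc r} eq = P.cong₂ (λ h L → concatMap (λ v → map (v VF.∷_) L) (chains _ h))
                                   (eq zero) (families-cong (λ i → eq (suc i)))

sumℕ-cong : ∀ {f g : Fin r → ℕ} → f ≗ g → sumℕ f ≡ sumℕ g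
sumℕ-cong {zero}  eq = P.refl
sumℕ-cong {suc r} eq = P.cong₂ ℕ._+_ (eq zero) (sumℕ-cong (λ i → eq (suc i)))

sumℕ-mono-≤ : ∀ {f g : Fin r → ℕ} → (∀ i → f i ≤ g i) → sumℕ f ≤ sumℕ g
sumℕ-mono-≤ {zero}  le = ℕ.z≤n
sumℕ-mono-≤ {suc r} le = ℕP.+-mono-≤ (le zero) (sumℕ-mono-≤ (λ i → le (suc i)))

f≤sumℕf : (f : Fin r → ℕ) (k : Fin r) → f k ≤ sumℕ f
f≤sumℕf f zero    = ℕP.m≤m+n (f zero) _
f≤sumℕf f (suc k) = ℕP.≤-trans (f≤sumℕf (λ i → f (suc i)) k) (ℕP.m≤n+m _ (f zero))

sumℕ-zero : (f : Fin r → ℕ) → (∀ i → f i ≡ 0) → sumℕ f ≡ 0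
sumℕ-zero {zero}  f eq = P.refl
sumℕ-zero {suc r} f eq = P.cong₂ ℕ._+_ (eq zero) (sumℕ-zero (λ i → f (suc i)) (λ i → eq (suc i)))

gap : (n m : Fin r → ℕ) → ℕ
gap n m = sumℕ λ i → n i ℕ.∸ m i

gap≤sumℕ : (n m : Fin r → ℕ) → gap n m ≤ sumℕ n
gap≤sumℕ n m = sumℕ-mono-≤ (λ i → ℕP.m∸n≤m (n i) (m i))

sumℕ-suc-at : (f g : Fin r → ℕ) (k : Fin r) → (∀ i → i P.≢ k → f i ≡ g i) → f k ≡ suc (g k) →
              sumℕ f ≡ suc (sumℕ g)
sumℕ-suc-at {suc r} f g zero    eq eqk = P.cong₂ ℕ._+_ eqk (sumℕ-cong (λ i → eq (suc i) (λ ())))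
sumℕ-suc-at {suc r} f g (suc k) eq eqk = P.trans
  (P.cong₂ ℕ._+_ (eq zero (λ ())) (sumℕ-suc-at (λ i → f (suc i)) (λ i → g (suc i)) k
                                      (λ i i≢k → eq (suc i) (i≢k ∘ FinP.suc-injective)) eqk))
  (ℕP.+-suc (g zero) _)

sumℕ-updateAt-pred : ∀ (n : Fin r → ℕ) k {a} → n k ≡ suc a → sumℕ n ≡ suc (sumℕ (updateAt n k (λ _ → a)))
sumℕ-updateAt-pred n k nₖ≡1+a = sumℕ-suc-at n (updateAt n k _) k
  (λ i i≢k → P.sym (updateAt-minimal i k n i≢k)) (P.trans nₖ≡1+a (P.cong suc (P.sym (updateAt-updates k n))))

gap-updateAt-pred : ∀ (n m : Fin r → ℕ) k {a} → n k ≡ suc a → m k ≤ a →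
                    gap n m ≡ suc (gap (updateAt n k (λ _ → a)) m)
gap-updateAt-pred n m k {a} nₖ≡1+a mₖ≤a = sumℕ-suc-at _ _ k
  (λ i i≢k → P.cong (ℕ._∸ m i) (P.sym (updateAt-minimal i k n i≢k)))
  (P.trans (P.cong (ℕ._∸ m k) nₖ≡1+a)
    (P.trans (ℕP.+-∸-assoc 1 mₖ≤a) (P.cong (λ b → suc (b ℕ.∸ m k)) (P.sym (updateAt-updates k n)))))

module RingSums {c ℓ : Level} (R : CommutativeRing c ℓ) where
  open CommutativeRing R hiding (zero)
  open import Relation.Binary.Reasoning.Setoid setoid
  open import Algebra.Solver.Ring.NaturalCoefficients.Default commutativeSemiring using (solve; _:=_; _:+_)

  x-y+y≈x : ∀ x y → (x - y) + y ≈ x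
  x-y+y≈x x y = trans (+-assoc x (- y) y) (trans (+-congˡ (-‿inverseˡ y)) (+-identityʳ x))

  x≈z+y⇒x-y≈z : ∀ {x y z} → x ≈ z + y → x - y ≈ z
  x≈z+y⇒x-y≈z {x} {y} {z} eq = begin
    x - y            ≈⟨ +-congʳ eq ⟩
    (z + y) - y      ≈⟨ +-assoc z y (- y) ⟩
    z + (y - y)      ≈⟨ +-congˡ (-‿inverseʳ y) ⟩
    z + 0#           ≈⟨ +-identityʳ z ⟩
    z                ∎

  private
    variable
      A B C : Set

  ∑ : List A → (A → Carrier) → Carrier
  ∑ []       f = 0#
  ∑ (a ∷ as) f = f a + ∑ as f

  infix 5 ∑
  syntax ∑ L (λ a → e) = ∑[ a ← L ] e

  ∑-cong-∈ : ∀ (L : List A) {f g} → (∀ a → a ∈ L → f a ≈ g a) → ∑ L f ≈ ∑ L g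
  ∑-cong-∈ []      eq = refl
  ∑-cong-∈ (a ∷ L) eq = +-cong (eq a (here P.refl)) (∑-cong-∈ L (λ b b∈L → eq b (there b∈L)))

  ∑-cong : ∀ (L : List A) {f g} → (∀ a → f a ≈ g a) → ∑ L f ≈ ∑ L g
  ∑-cong L eq = ∑-cong-∈ L (λ a _ → eq a)

  ∑-++ : ∀ (L M : List A) f → ∑ (L ++ M) f ≈ ∑ L f + ∑ M f
  ∑-++ []      M f = sym (+-identityˡ _)
  ∑-++ (a ∷ L) M f = trans (+-congˡ (∑-++ L M f)) (sym (+-assoc _ _ _))

  ∑-zero : ∀ (L : List A) → ∑[ a ← L ] 0# ≈ 0#
  ∑-zero []      = refl
  ∑-zero (a ∷ L) = trans (+-identityˡ _) (∑-zero L)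

  ∑-+ : ∀ (L : List A) f g → ∑[ a ← L ] (f a + g a) ≈ ∑ L f + ∑ L g
  ∑-+ []      f g = sym (+-identityˡ _)
  ∑-+ (a ∷ L) f g = trans (+-congˡ (∑-+ L f g))
    (solve 4 (λ u v w z → (u :+ v) :+ (w :+ z) := (u :+ w) :+ (v :+ z)) refl (f a) (g a) (∑ L f) (∑ L g))

  ∑-*ˡ : ∀ (L : List A) x f → x * ∑ L f ≈ ∑[ a ← L ] (x * f a)
  ∑-*ˡ []      x f = zeroʳ x
  ∑-*ˡ (a ∷ L) x f = trans (distribˡ x _ _) (+-congˡ (∑-*ˡ L x f))

  ∑-sub : ∀ (L : List A) f g → ∑ L f - ∑ L g ≈ ∑[ a ← L ] (f a - g a)
  ∑-sub L f g = x≈z+y⇒x-y≈z (trans (∑-cong L (λ a → sym (x-y+y≈x (f a) (g a)))) (∑-+ L _ g))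

  ∑-comm : ∀ (L : List A) (M : List B) (h : A → B → Carrier) →
           ∑[ a ← L ] ∑ M (h a) ≈ ∑[ b ← M ] ∑[ a ← L ] h a b
  ∑-comm []      M h = sym (∑-zero M)
  ∑-comm (a ∷ L) M h = trans (+-congˡ (∑-comm L M h)) (sym (∑-+ M (h a) _))

  ∑-concatMap-map : ∀ (L : List A) (M : A → List B) (g : A → B → C) f →
                    ∑ (concatMap (λ a → map (g a) (M a)) L) f ≈ ∑[ a ← L ] ∑[ b ← M a ] f (g a b)
  ∑-concatMap-map []      M g f = refl
  ∑-concatMap-map (a ∷ L) M g f = begin
    ∑ (map (g a) (M a) ++ concatMap (λ a → map (g a) (M a)) L) f
      ≈⟨ ∑-++ (map (g a) (M a)) _ f ⟩
    ∑ (map (g a) (M a)) f + ∑ (concatMap (λ a → map (g a) (M a)) L) f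
      ≈⟨ +-cong (reflexive (∑-map (M a))) (∑-concatMap-map L M g f) ⟩
    (∑[ b ← M a ] f (g a b)) + (∑[ a ← L ] ∑[ b ← M a ] f (g a b)) ∎
    where
    ∑-map : ∀ (K : List _) → ∑ (map (g a) K) f ≡ ∑[ b ← K ] f (g a b)
    ∑-map []      = P.refl
    ∑-map (b ∷ K) = P.cong (f (g a b) +_) (∑-map K)

  ∑-upTo-suc : ∀ k f → ∑ (upTo (suc k)) f ≈ ∑ (upTo k) f + f k
  ∑-upTo-suc k f = begin
    ∑ (upTo (suc k)) f      ≡⟨ P.cong (λ L → ∑ L f) (upTo-∷ʳ k) ⟨
    ∑ (upTo k ++ [ k ]) f   ≈⟨ ∑-++ (upTo k) [ k ] f ⟩
    ∑ (upTo k) f + (f k + 0#) ≈⟨ +-congˡ (+-identityʳ _) ⟩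
    ∑ (upTo k) f + f k      ∎

  ∑-families-suc : ∀ {q} r (n : Fin r → ℕ) (f : (Fin r → Vec ℕ (suc (suc q))) → Carrier) →
                   f Preserves _≗_ ⟶ _≈_ →
                   ∑ (families (suc q) r n) f ≈ ∑[ m ← boxes r n ] ∑[ G ← families q r m ] f (λ i → n i ∷ G i)
  ∑-families-suc zero    n f f-cong = +-congʳ (trans (f-cong (λ ())) (sym (+-identityʳ _)))
  ∑-families-suc {q} (suc r) n f f-cong = begin
    ∑ (families (suc q) (suc r) n) f
      ≈⟨ ∑-concatMap-map (chains (suc q) (n zero)) (λ _ → families (suc q) r (tail n)) VF._∷_ f ⟩
    ∑[ v ← chains (suc q) (n zero) ] ∑[ N ← families (suc q) r (tail n) ] f (v VF.∷ N)
      ≈⟨ ∑-cong (chains (suc q) (n zero)) (λ v → ∑-families-suc r (tail n) (λ N → f (v VF.∷ N))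
                                                 (λ eq → f-cong (λ { zero → P.refl ; (suc i) → eq i }))) ⟩
    ∑[ v ← chains (suc q) (n zero) ] ∑[ m ← boxes r (tail n) ] ∑[ G ← families q r m ] f (v VF.∷ row G)
      ≈⟨ ∑-concatMap-map (upTo (suc (n zero))) (chains q) (λ _ → n zero ∷_) _ ⟩
    ∑[ a ← upTo (suc (n zero)) ] ∑[ g ← chains q a ] ∑[ m ← boxes r (tail n) ] ∑[ G ← families q r m ]
      f ((n zero ∷ g) VF.∷ row G)
      ≈⟨ ∑-cong (upTo (suc (n zero))) (λ a → ∑-comm (chains q a) (boxes r (tail n)) _) ⟩
    ∑[ a ← upTo (suc (n zero)) ] ∑[ m ← boxes r (tail n) ] ∑[ g ← chains q a ] ∑[ G ← families q r m ]
      f ((n zero ∷ g) VF.∷ row G)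
      ≈⟨ ∑-cong (upTo (suc (n zero))) (λ a → ∑-cong (boxes r (tail n)) (λ m → sym (trans
           (∑-concatMap-map (chains q a) (λ _ → families q r m) VF._∷_ _)
           (∑-cong (chains q a) (λ g → ∑-cong (families q r m) (λ G →
             f-cong (λ { zero → P.refl ; (suc i) → P.refl }))))))) ⟩
    ∑[ a ← upTo (suc (n zero)) ] ∑[ m ← boxes r (tail n) ] ∑[ G ← families q (suc r) (a VF.∷ m) ]
      f (λ i → n i ∷ G i)
      ≈⟨ ∑-concatMap-map (upTo (suc (n zero))) (λ _ → boxes r (tail n)) VF._∷_ _ ⟨
    ∑[ m ← boxes (suc r) n ] ∑[ G ← families q (suc r) m ] f (λ i → n i ∷ G i) ∎
    where
    row : (Fin r → Vec ℕ (suc q)) → Fin r → Vec ℕ (suc (suc q))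
    row G i = n (suc i) ∷ G i

  ∑-boxes-updateAt : ∀ {r} (n : Fin r → ℕ) k {a} → n k ≡ suc a → (g : (Fin r → ℕ) → Carrier) →
                     (∀ m → m k ≡ suc a → g m ≈ 0#) →
                     ∑ (boxes r (updateAt n k (λ _ → a))) g ≈ ∑ (boxes r n) g
  ∑-boxes-updateAt {suc r} n zero {a} n₀≡1+a g g≈0 = begin
    ∑ (boxes (suc r) (updateAt n zero (λ _ → a))) g
      ≈⟨ ∑-concatMap-map (upTo (suc a)) (λ _ → boxes r (tail n)) VF._∷_ g ⟩
    ∑ (upTo (suc a)) h
      ≈⟨ +-identityʳ _ ⟨
    ∑ (upTo (suc a)) h + 0#
      ≈⟨ +-congˡ (trans (∑-cong (boxes r (tail n)) (λ m → g≈0 (suc a VF.∷ m) P.refl))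
                        (∑-zero (boxes r (tail n)))) ⟨
    ∑ (upTo (suc a)) h + h (suc a)
      ≈⟨ ∑-upTo-suc (suc a) h ⟨
    ∑ (upTo (suc (suc a))) h
      ≡⟨ P.cong (λ b → ∑ (upTo (suc b)) h) n₀≡1+a ⟨
    ∑ (upTo (suc (n zero))) h
      ≈⟨ ∑-concatMap-map (upTo (suc (n zero))) (λ _ → boxes r (tail n)) VF._∷_ g ⟨
    ∑ (boxes (suc r) n) g ∎
    where
    h : ℕ → Carrier
    h b = ∑[ m ← boxes r (tail n) ] g (b VF.∷ m)
  ∑-boxes-updateAt {suc r} n (suc k) {a} nₖ≡1+a g g≈0 = begin
    ∑ (boxes (suc r) (updateAt n (suc k) (λ _ → a))) g
      ≈⟨ ∑-concatMap-map (upTo (suc (n zero))) (λ _ → boxes r (updateAt (tail n) k (λ _ → a))) VF._∷_ g ⟩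
    ∑[ b ← upTo (suc (n zero)) ] ∑[ m ← boxes r (updateAt (tail n) k (λ _ → a)) ] g (b VF.∷ m)
      ≈⟨ ∑-cong (upTo (suc (n zero))) (λ b →
           ∑-boxes-updateAt (tail n) k nₖ≡1+a (λ m → g (b VF.∷ m)) (λ m → g≈0 (b VF.∷ m))) ⟩
    ∑[ b ← upTo (suc (n zero)) ] ∑[ m ← boxes r (tail n) ] g (b VF.∷ m)
      ≈⟨ ∑-concatMap-map (upTo (suc (n zero))) (λ _ → boxes r (tail n)) VF._∷_ g ⟨
    ∑ (boxes (suc r) n) g ∎

  ∑-boxes-corner : ∀ {r} (n : Fin r → ℕ) (g : (Fin r → ℕ) → Carrier) {x} →
                   (∀ m → m ≗ n → g m ≈ x) → (∀ m → Pointwise _≤_ m n → ¬ m ≗ n → g m ≈ 0#) →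
                   ∑ (boxes r n) g ≈ x
  ∑-boxes-corner {zero}  n g at-n _ = trans (+-identityʳ _) (at-n _ (λ ()))
  ∑-boxes-corner {suc r} n g {x} at-n elsewhere = begin
    ∑ (boxes (suc r) n) g                        ≈⟨ ∑-concatMap-map (upTo (suc (n zero))) (λ _ → boxes r (tail n)) VF._∷_ g ⟩
    ∑ (upTo (suc (n zero))) h                    ≈⟨ ∑-upTo-suc (n zero) h ⟩
    ∑ (upTo (n zero)) h + h (n zero)             ≈⟨ +-cong below-corner at-corner ⟩
    0# + x                                       ≈⟨ +-identityˡ x ⟩
    x                                            ∎
    where
    h : ℕ → Carrier
    h a = ∑[ m ← boxes r (tail n) ] g (a VF.∷ m)
    below-corner : ∑ (upTo (n zero)) h ≈ 0#
    below-corner = trans (∑-cong-∈ (upTo (n zero)) λ a a∈ → trans (∑-cong-∈ (boxes r (tail n)) λ m m∈ →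
        elsewhere _ (λ { zero → ℕP.<⇒≤ (∈-upTo⁻ a∈) ; (suc i) → ∈-boxes⁻ m∈ i })
                    (λ eq → ℕP.<⇒≢ (∈-upTo⁻ a∈) (eq zero)))
      (∑-zero (boxes r (tail n)))) (∑-zero (upTo (n zero)))
    at-corner : h (n zero) ≈ x
    at-corner = ∑-boxes-corner (tail n) (λ m → g (n zero VF.∷ m))
      (λ m eq → at-n _ (λ { zero → P.refl ; (suc i) → eq i }))
      (λ m le ne → elsewhere _ (λ { zero → ℕP.≤-refl ; (suc i) → le i }) (λ eq → ne (λ i → eq (suc i))))

module _ {a ℓ : Level} (F : CharZeroField a ℓ) where
  open CharZeroField F
  open RingSums commRing
  open import Relation.Binary.Reasoning.Setoid setoid
  open import Algebra.Solver.Ring.NaturalCoefficients.Default commutativeSemiring using (solve; _:=_; _:+_; _:*_)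
  open import Algebra.Properties.Ring ring using ([y-z]x≈yx-zx)

  private
    x*[y*z]≈y*[x*z] : ∀ x y z → x * (y * z) ≈ y * (x * z)
    x*[y*z]≈y*[x*z] = solve 3 (λ x y z → x :* (y :* z) := y :* (x :* z)) refl

    [x*y]*[z*w]≈[x*z]*[y*w] : ∀ x y z w → (x * y) * (z * w) ≈ (x * z) * (y * w)
    [x*y]*[z*w]≈[x*z]*[y*w] = solve 4 (λ x y z w → (x :* y) :* (z :* w) := (x :* z) :* (y :* w)) refl

  x≉0⇒x⁻¹*[x*y]≈y : ∀ {x} y → x ≉ 0# → x ⁻¹ * (x * y) ≈ y
  x≉0⇒x⁻¹*[x*y]≈y {x} y x≉0 = begin
    x ⁻¹ * (x * y)   ≈⟨ x*[y*z]≈y*[x*z] (x ⁻¹) x y ⟩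
    x * (x ⁻¹ * y)   ≈⟨ sym (*-assoc x (x ⁻¹) y) ⟩
    (x * x ⁻¹) * y   ≈⟨ *-congʳ (⁻¹-inverse x x≉0) ⟩
    1# * y           ≈⟨ *-identityˡ y ⟩
    y                ∎

  *-≉0 : ∀ {x y} → x ≉ 0# → y ≉ 0# → x * y ≉ 0#
  *-≉0 {x} {y} x≉0 y≉0 xy≈0 =
    y≉0 (trans (sym (x≉0⇒x⁻¹*[x*y]≈y y x≉0)) (trans (*-congˡ xy≈0) (zeroʳ _)))

  ⁻¹-≉0 : ∀ {x} → x ≉ 0# → x ⁻¹ ≉ 0#
  ⁻¹-≉0 {x} x≉0 x⁻¹≈0 = 1≉0 (trans (sym (⁻¹-inverse x x≉0)) (trans (*-congˡ x⁻¹≈0) (zeroʳ x)))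

  ⁻¹-unique : ∀ {x y} → x ≉ 0# → x * y ≈ 1# → y ≈ x ⁻¹
  ⁻¹-unique {x} {y} x≉0 xy≈1 =
    trans (sym (x≉0⇒x⁻¹*[x*y]≈y y x≉0)) (trans (*-congˡ xy≈1) (*-identityʳ _))

  ⁻¹-cong : ∀ {x y} → x ≉ 0# → x ≈ y → x ⁻¹ ≈ y ⁻¹
  ⁻¹-cong x≉0 x≈y = ⁻¹-unique (x≉0 ∘ trans x≈y) (trans (*-congʳ (sym x≈y)) (⁻¹-inverse _ x≉0))

  ⁻¹-distrib-* : ∀ {x y} → x ≉ 0# → y ≉ 0# → (x * y) ⁻¹ ≈ x ⁻¹ * y ⁻¹
  ⁻¹-distrib-* {x} {y} x≉0 y≉0 = sym (⁻¹-unique (*-≉0 x≉0 y≉0) (begin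
    (x * y) * (x ⁻¹ * y ⁻¹)    ≈⟨ [x*y]*[z*w]≈[x*z]*[y*w] x y (x ⁻¹) (y ⁻¹) ⟩
    (x * x ⁻¹) * (y * y ⁻¹)    ≈⟨ *-cong (⁻¹-inverse x x≉0) (⁻¹-inverse y y≉0) ⟩
    1# * 1#                    ≈⟨ *-identityˡ 1# ⟩
    1#                         ∎))

  cross-multiply : ∀ {u v d e} → d ≉ 0# → e ≉ 0# → u * e ≈ v * d → u * d ⁻¹ ≈ v * e ⁻¹
  cross-multiply {u} {v} {d} {e} d≉0 e≉0 ue≈vd = begin
    u * d ⁻¹                   ≈⟨ sym (x≉0⇒x⁻¹*[x*y]≈y _ e≉0) ⟩
    e ⁻¹ * (e * (u * d ⁻¹))    ≈⟨ *-congˡ (solve 3 (λ e u d → e :* (u :* d) := (u :* e) :* d) refl e u (d ⁻¹)) ⟩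
    e ⁻¹ * ((u * e) * d ⁻¹)    ≈⟨ *-congˡ (*-congʳ ue≈vd) ⟩
    e ⁻¹ * ((v * d) * d ⁻¹)    ≈⟨ *-congˡ (trans (*-assoc v d (d ⁻¹))
                                           (trans (*-congˡ (⁻¹-inverse d d≉0)) (*-identityʳ v))) ⟩
    e ⁻¹ * v                   ≈⟨ *-comm (e ⁻¹) v ⟩
    v * e ⁻¹                   ∎

  ι-+ : ∀ m n → ι (m ℕ.+ n) ≈ ι m + ι n
  ι-+ zero    n = sym (+-identityˡ _)
  ι-+ (suc m) n = trans (+-congˡ (ι-+ m n)) (sym (+-assoc _ _ _))

  ι-* : ∀ m n → ι (m ℕ.* n) ≈ ι m * ι n
  ι-* zero    n = sym (zeroˡ _)
  ι-* (suc m) n = begin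
    ι (n ℕ.+ m ℕ.* n)            ≈⟨ trans (ι-+ n (m ℕ.* n)) (+-congˡ (ι-* m n)) ⟩
    ι n + ι m * ι n              ≈⟨ +-congʳ (sym (*-identityˡ _)) ⟩
    1# * ι n + ι m * ι n         ≈⟨ sym (distribʳ _ _ _) ⟩
    (1# + ι m) * ι n             ∎

  ι-!≉0 : ∀ n → ι (n !) ≉ 0#
  ι-!≉0 n = charZero (ℕ.pred (n !)) ∘ trans (reflexive (P.cong ι (ℕP.suc-pred (n !) {{n ℕP.!≢0}})))

  ι1⁻¹≈1 : ι 1 ⁻¹ ≈ 1#
  ι1⁻¹≈1 = sym (⁻¹-unique (charZero 0) (trans (*-identityʳ _) (+-identityʳ 1#)))

  binomialTerm-absorb : ∀ z {a b} → b ≤ a →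
                        (z * ι (suc a)) * (ι (a C b) * z ^ (a ℕ.∸ b))
                          ≈ ι (suc a ℕ.∸ b) * (ι (suc a C b) * z ^ (suc a ℕ.∸ b))
  binomialTerm-absorb z {a} {b} b≤a = begin
    (z * ι (suc a)) * (ι (a C b) * z ^ (a ℕ.∸ b))
      ≈⟨ solve 4 (λ z s c p → (z :* s) :* (c :* p) := (s :* c) :* (z :* p)) refl z (ι (suc a)) (ι (a C b)) (z ^ (a ℕ.∸ b)) ⟩
    (ι (suc a) * ι (a C b)) * z ^ suc (a ℕ.∸ b)
      ≈⟨ *-congʳ (trans (sym (ι-* (suc a) (a C b)))
                        (trans (reflexive (P.cong ι (C-absorb b≤a))) (ι-* (suc (a ℕ.∸ b)) (suc a C b)))) ⟩
    (ι (suc (a ℕ.∸ b)) * ι (suc a C b)) * z ^ suc (a ℕ.∸ b)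
      ≈⟨ *-assoc _ _ _ ⟩
    ι (suc (a ℕ.∸ b)) * (ι (suc a C b) * z ^ suc (a ℕ.∸ b))
      ≡⟨ P.cong (λ d → ι d * (ι (suc a C b) * z ^ d)) (ℕP.+-∸-assoc 1 b≤a) ⟨
    ι (suc a ℕ.∸ b) * (ι (suc a C b) * z ^ (suc a ℕ.∸ b)) ∎

  sumF-cong : ∀ {f g : Fin r → Carrier} → (∀ i → f i ≈ g i) → sumF f ≈ sumF g
  sumF-cong {zero}  eq = refl
  sumF-cong {suc r} eq = +-cong (eq zero) (sumF-cong (λ i → eq (suc i)))

  sumF-zero : ∀ {f : Fin r → Carrier} → (∀ i → f i ≈ 0#) → sumF f ≈ 0#
  sumF-zero {zero}  eq = refl
  sumF-zero {suc r} eq = trans (+-cong (eq zero) (sumF-zero (λ i → eq (suc i)))) (+-identityˡ 0#)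

  sumF-*ʳ : ∀ (f : Fin r → Carrier) x → sumF f * x ≈ sumF (λ k → f k * x)
  sumF-*ʳ {zero}  f x = zeroˡ x
  sumF-*ʳ {suc r} f x = trans (distribʳ x _ _) (+-congˡ (sumF-*ʳ (λ k → f (suc k)) x))

  sumF-ι : ∀ (f : Fin r → ℕ) → sumF (λ i → ι (f i)) ≈ ι (sumℕ f)
  sumF-ι {zero}  f = refl
  sumF-ι {suc r} f = trans (+-congˡ (sumF-ι (λ i → f (suc i)))) (sym (ι-+ (f zero) _))

  sumF-∑ : ∀ {A : Set} (L : List A) (g : Fin r → A → Carrier) →
           sumF (λ k → ∑ L (g k)) ≈ ∑[ a ← L ] sumF (λ k → g k a)
  sumF-∑ {zero}  L g = sym (∑-zero L)
  sumF-∑ {suc r} L g = trans (+-congˡ (sumF-∑ L (λ k → g (suc k)))) (sym (∑-+ L (g zero) _))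

  prodF-≗ : ∀ {f g : Fin r → Carrier} → f ≗ g → prodF f ≡ prodF g
  prodF-≗ {zero}  eq = P.refl
  prodF-≗ {suc r} eq = P.cong₂ _*_ (eq zero) (prodF-≗ (λ i → eq (suc i)))

  prodF-cong : ∀ {f g : Fin r → Carrier} → (∀ i → f i ≈ g i) → prodF f ≈ prodF g
  prodF-cong {zero}  eq = refl
  prodF-cong {suc r} eq = *-cong (eq zero) (prodF-cong (λ i → eq (suc i)))

  prodF-* : ∀ (f g : Fin r → Carrier) → prodF (λ i → f i * g i) ≈ prodF f * prodF g
  prodF-* {zero}  f g = sym (*-identityˡ 1#)
  prodF-* {suc r} f g = trans (*-congˡ (prodF-* (λ i → f (suc i)) (λ i → g (suc i))))
                              ([x*y]*[z*w]≈[x*z]*[y*w] (f zero) (g zero) _ _)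

  prodF-≉0 : ∀ {f : Fin r → Carrier} → (∀ i → f i ≉ 0#) → prodF f ≉ 0#
  prodF-≉0 {zero}  f≉0 = 1≉0
  prodF-≉0 {suc r} f≉0 = *-≉0 (f≉0 zero) (prodF-≉0 (λ i → f≉0 (suc i)))

  prodF-one : ∀ {f : Fin r → Carrier} → (∀ i → f i ≈ 1#) → prodF f ≈ 1#
  prodF-one {zero}  eq = refl
  prodF-one {suc r} eq = trans (*-cong (eq zero) (prodF-one (λ i → eq (suc i)))) (*-identityˡ 1#)

  prodF-zero : ∀ (f : Fin r → Carrier) k → f k ≈ 0# → prodF f ≈ 0#
  prodF-zero f zero    eq = trans (*-congʳ eq) (zeroˡ _)
  prodF-zero f (suc k) eq = trans (*-congˡ (prodF-zero (λ i → f (suc i)) k eq)) (zeroʳ _)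

  prodF-scale-at : ∀ (f g : Fin r → Carrier) k {x y} → (∀ i → i P.≢ k → f i ≈ g i) →
                   x * f k ≈ y * g k → x * prodF f ≈ y * prodF g
  prodF-scale-at f g zero {x} {y} eq eqk = begin
    x * (f zero * prodF (λ i → f (suc i)))   ≈⟨ sym (*-assoc _ _ _) ⟩
    (x * f zero) * prodF (λ i → f (suc i))   ≈⟨ *-cong eqk (prodF-cong (λ i → eq (suc i) (λ ()))) ⟩
    (y * g zero) * prodF (λ i → g (suc i))   ≈⟨ *-assoc _ _ _ ⟩
    y * (g zero * prodF (λ i → g (suc i)))   ∎
  prodF-scale-at f g (suc k) {x} {y} eq eqk = begin
    x * (f zero * prodF (λ i → f (suc i)))   ≈⟨ x*[y*z]≈y*[x*z] x _ _ ⟩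
    f zero * (x * prodF (λ i → f (suc i)))   ≈⟨ *-cong (eq zero (λ ())) (prodF-scale-at (λ i → f (suc i)) (λ i → g (suc i)) k
                                                  (λ i i≢k → eq (suc i) (i≢k ∘ FinP.suc-injective)) eqk) ⟩
    g zero * (y * prodF (λ i → g (suc i)))   ≈⟨ x*[y*z]≈y*[x*z] _ y _ ⟩
    y * (g zero * prodF (λ i → g (suc i)))   ∎

  falling-cong : ∀ {z z′} m → z ≈ z′ → falling z m ≈ falling z′ m
  falling-cong zero    eq = refl
  falling-cong (suc m) eq = *-cong (falling-cong m eq) (+-congʳ eq)

  falling-≉0 : ∀ z m → (∀ j → j < m → z - ι j ≉ 0#) → falling z m ≉ 0#
  falling-≉0 z zero    _   = 1≉0
  falling-≉0 z (suc m) z≉j = *-≉0 (falling-≉0 z m (λ j j<m → z≉j j (ℕP.m<n⇒m<1+n j<m))) (z≉j m (ℕP.n<1+n m))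

  falling-suc : ∀ z k → falling z (suc k) ≈ z * falling (z - 1#) k
  falling-suc z zero = begin
    1# * (z - 0#)      ≈⟨ *-identityˡ _ ⟩
    z - 0#             ≈⟨ x≈z+y⇒x-y≈z (sym (+-identityʳ z)) ⟩
    z                  ≈⟨ sym (*-identityʳ z) ⟩
    z * 1#             ∎
  falling-suc z (suc k) = begin
    falling z (suc k) * (z - ι (suc k))            ≈⟨ *-cong (falling-suc z k) z-[1+k]≈z-1-k ⟩
    (z * falling (z - 1#) k) * ((z - 1#) - ι k)    ≈⟨ *-assoc _ _ _ ⟩
    z * (falling (z - 1#) k * ((z - 1#) - ι k))    ∎
    where
    z-[1+k]≈z-1-k : z - ι (suc k) ≈ (z - 1#) - ι k
    z-[1+k]≈z-1-k = sym (x≈z+y⇒x-y≈z (x≈z+y⇒x-y≈z (begin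
      z                                   ≈⟨ sym (x-y+y≈x z (ι (suc k))) ⟩
      (z - ι (suc k)) + (1# + ι k)        ≈⟨ solve 3 (λ a o k → a :+ (o :+ k) := (a :+ k) :+ o) refl (z - ι (suc k)) 1# (ι k) ⟩
      ((z - ι (suc k)) + ι k) + 1#        ∎)))

  binom-cong : ∀ {z z′} m → z ≈ z′ → binom z m ≈ binom z′ m
  binom-cong m eq = *-congʳ (falling-cong m eq)

  binom-absorb : ∀ z v → ι (suc v) * binom z (suc v) ≈ z * binom (z - 1#) v
  binom-absorb z v = begin
    ι (suc v) * (falling z (suc v) * ι (suc v !) ⁻¹)
      ≈⟨ *-congˡ (*-cong (falling-suc z v) [1+v]!⁻¹) ⟩
    ι (suc v) * ((z * falling (z - 1#) v) * (ι (suc v) ⁻¹ * ι (v !) ⁻¹))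
      ≈⟨ solve 5 (λ s a b s⁻¹ f⁻¹ → s :* ((a :* b) :* (s⁻¹ :* f⁻¹)) := (s :* s⁻¹) :* (a :* (b :* f⁻¹))) refl
               (ι (suc v)) z (falling (z - 1#) v) (ι (suc v) ⁻¹) (ι (v !) ⁻¹) ⟩
    (ι (suc v) * ι (suc v) ⁻¹) * (z * binom (z - 1#) v)
      ≈⟨ trans (*-congʳ (⁻¹-inverse _ (charZero v))) (*-identityˡ _) ⟩
    z * binom (z - 1#) v ∎
    where
    [1+v]!⁻¹ : ι (suc v !) ⁻¹ ≈ ι (suc v) ⁻¹ * ι (v !) ⁻¹
    [1+v]!⁻¹ = trans (⁻¹-cong (ι-!≉0 (suc v)) (ι-* (suc v) (v !))) (⁻¹-distrib-* (charZero v) (ι-!≉0 v))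

  den : Carrier → ℕ → ℕ → Carrier
  den t S V = binom (ι S + t - 1#) V * (ι S + t)

  den-≉0 : ∀ {t S V} → NotNonPosInt t → V ≤ S → den t S V ≉ 0#
  den-≉0 {t} {S} {V} t∉ℤ≤0 V≤S = *-≉0 (*-≉0 (falling-≉0 _ V factor≉0) (⁻¹-≉0 (ι-!≉0 V)))
                                      (t∉ℤ≤0 S ∘ trans (+-comm t (ι S)))
    where
    factor≉0 : ∀ j → j < V → (ι S + t - 1#) - ι j ≉ 0#
    factor≉0 j j<V = t∉ℤ≤0 d ∘ trans (sym factor≈t+d)
      where
      d = S ℕ.∸ suc j
      factor≈t+d : (ι S + t - 1#) - ι j ≈ t + ι d
      factor≈t+d = x≈z+y⇒x-y≈z (x≈z+y⇒x-y≈z (begin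
        ι S + t                     ≈⟨ +-congʳ (reflexive (P.cong ι (ℕP.m+[n∸m]≡n (ℕP.≤-trans j<V V≤S)))) ⟨
        ι (suc j ℕ.+ d) + t         ≈⟨ +-congʳ (ι-+ (suc j) d) ⟩
        (1# + ι j + ι d) + t        ≈⟨ solve 4 (λ o a b t → (o :+ a :+ b) :+ t := ((t :+ b) :+ a) :+ o) refl 1# (ι j) (ι d) t ⟩
        ((t + ι d) + ι j) + 1#      ∎))

  den-zero : ∀ t S → den t S 0 ≈ ι S + t
  den-zero t S = trans (*-congʳ (trans (*-identityˡ _) ι1⁻¹≈1)) (*-identityˡ _)

  den-suc : ∀ t {S V} N v → S ≡ suc N → V ≡ suc v → (ι S + t) * den t N v ≈ ι V * den t S V
  den-suc t N v P.refl P.refl = begin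
    (1# + ι N + t) * (binom (w - 1#) v * w)
      ≈⟨ *-congʳ (+-assoc 1# (ι N) t) ⟩
    (1# + w) * (binom (w - 1#) v * w)
      ≈⟨ solve 3 (λ o w b → (o :+ w) :* (b :* w) := (w :* b) :* (o :+ w)) refl 1# w (binom (w - 1#) v) ⟩
    (w * binom (w - 1#) v) * (1# + w)
      ≈⟨ *-congʳ (binom-absorb w v) ⟨
    (ι (suc v) * binom w (suc v)) * (1# + w)
      ≈⟨ trans (*-assoc _ _ _) (*-congˡ (*-cong (binom-cong (suc v) (sym w′-1≈w)) (sym (+-assoc 1# (ι N) t)))) ⟩
    ι (suc v) * (binom (ι (suc N) + t - 1#) (suc v) * (ι (suc N) + t)) ∎
    where
    w = ι N + t
    w′-1≈w : ι (suc N) + t - 1# ≈ w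
    w′-1≈w = x≈z+y⇒x-y≈z (trans (+-assoc 1# (ι N) t) (+-comm 1# w))

  rowTerm : ∀ {q} → (Fin (suc q) → Carrier) → ℕ → Vec ℕ (suc q) → Carrier
  rowTerm y a v = ι (multinomial a (diffs v)) * prodF (λ j → y j ^ lookup (diffs v) j)

  -- cTerm q t x n N unfolds to numerator q x n N * denominator q t N ⁻¹.
  numerator : ∀ q → (Fin r → Fin (suc q) → Carrier) → (Fin r → ℕ) → (Fin r → Vec ℕ (suc q)) → Carrier
  numerator q x n N = prodF λ i → rowTerm (x i) (n i) (N i)

  denominator : ∀ q → (Fin q → Carrier) → (Fin r → Vec ℕ (suc q)) → Carrier
  denominator q t N = prodF λ j → den (t j) (sumℕ λ i → lookup (N i) (inject₁ j))
                                            (sumℕ λ i → lookup (diffs (N i)) (inject₁ j))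


  leading : (Fin r → Carrier) → (Fin r → ℕ) → (Fin r → ℕ) → Carrier
  leading y n m = prodF λ i → ι (n i C m i) * y i ^ (n i ℕ.∸ m i)

  layerCoeff : Carrier → (Fin r → Carrier) → (Fin r → ℕ) → (Fin r → ℕ) → Carrier
  layerCoeff t y n m = leading y n m * den t (sumℕ n) (gap n m) ⁻¹

  rowTerm-∷ : ∀ (y : Fin (suc (suc q)) → Carrier) {a m} {g : Vec ℕ (suc q)} → m ≤ a → Chain m g →
              rowTerm y a (a ∷ g) ≈ (ι (a C m) * y zero ^ (a ℕ.∸ m)) * rowTerm (tail y) m g
  rowTerm-∷ y {a} {m} {g} m≤a ch rewrite diffs-∷ {a = a} ch = begin
    ι (multinomial a ((a ℕ.∸ m) ∷ diffs g)) * (y zero ^ (a ℕ.∸ m) * P)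
      ≈⟨ *-congʳ (trans (reflexive (P.cong ι (multinomial-∷ (diffs g) m≤a (prodFact-diffs∣! ch))))
                        (ι-* (a C m) (multinomial m (diffs g)))) ⟩
    (ι (a C m) * ι (multinomial m (diffs g))) * (y zero ^ (a ℕ.∸ m) * P)
      ≈⟨ [x*y]*[z*w]≈[x*z]*[y*w] _ _ _ _ ⟩
    (ι (a C m) * y zero ^ (a ℕ.∸ m)) * (ι (multinomial m (diffs g)) * P) ∎
    where P = prodF (λ j → y (suc j) ^ lookup (diffs g) j)

  module _ {q} {n m : Fin r → ℕ} {G : Fin r → Vec ℕ (suc q)} (G-chains : ∀ i → Chain (m i) (G i)) where

    numerator-∷ : ∀ (x : Fin r → Fin (suc (suc q)) → Carrier) → (∀ i → m i ≤ n i) →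
                  numerator (suc q) x n (λ i → n i ∷ G i)
                    ≈ leading (λ i → x i zero) n m * numerator q (λ i → tail (x i)) m G
    numerator-∷ x m≤n = trans (prodF-cong (λ i → rowTerm-∷ (x i) (m≤n i) (G-chains i)))
                              (prodF-* (λ i → ι (n i C m i) * x i zero ^ (n i ℕ.∸ m i)) (λ i → rowTerm (tail (x i)) (m i) (G i)))

    denominator-∷ : ∀ (t : Fin (suc q) → Carrier) →
                    denominator (suc q) t (λ i → n i ∷ G i)
                      ≡ den (t zero) (sumℕ n) (gap n m) * denominator q (tail t) G
    denominator-∷ t = P.cong₂ _*_
      (P.cong (den (t zero) (sumℕ n)) (sumℕ-cong (λ i → P.cong (λ d → lookup d zero) (diffs-∷ (G-chains i)))))
      (prodF-≗ (λ j → P.cong (den (t (suc j)) (sumℕ λ i → lookup (G i) (inject₁ j)))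
                             (sumℕ-cong (λ i → P.cong (λ d → lookup d (suc (inject₁ j))) (diffs-∷ (G-chains i))))))

  denominator-≉0 : ∀ q {t : Fin q → Carrier} → (∀ j → NotNonPosInt (t j)) → (N : Fin r → Vec ℕ (suc q)) →
                   denominator q t N ≉ 0#
  denominator-≉0 q t∉ℤ≤0 N =
    prodF-≉0 λ j → den-≉0 (t∉ℤ≤0 j) (sumℕ-mono-≤ (λ i → lookup-diffs≤lookup (N i) (inject₁ j)))

  cTerm-∷ : ∀ q (t : Fin (suc q) → Carrier) (x : Fin r → Fin (suc (suc q)) → Carrier) →
            (∀ j → NotNonPosInt (t j)) → ∀ {n m G} → (∀ i → m i ≤ n i) → (∀ i → Chain (m i) (G i)) →
            cTerm (suc q) t x n (λ i → n i ∷ G i)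
              ≈ layerCoeff (t zero) (λ i → x i zero) n m * cTerm q (tail t) (λ i → tail (x i)) m G
  cTerm-∷ q t x t∉ℤ≤0 {n} {m} {G} m≤n G-chains = begin
    numerator (suc q) x n (λ i → n i ∷ G i) * denominator (suc q) t (λ i → n i ∷ G i) ⁻¹
      ≈⟨ *-cong (numerator-∷ G-chains x m≤n) (reflexive (P.cong _⁻¹ (denominator-∷ G-chains t))) ⟩
    (L * num) * (D * den′) ⁻¹
      ≈⟨ *-congˡ (⁻¹-distrib-* (den-≉0 (t∉ℤ≤0 zero) (gap≤sumℕ n m)) (denominator-≉0 q (t∉ℤ≤0 ∘ suc) G)) ⟩
    (L * num) * (D ⁻¹ * den′ ⁻¹)
      ≈⟨ [x*y]*[z*w]≈[x*z]*[y*w] L num (D ⁻¹) (den′ ⁻¹) ⟩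
    (L * D ⁻¹) * (num * den′ ⁻¹) ∎
    where
    L    = leading (λ i → x i zero) n m
    D    = den (t zero) (sumℕ n) (gap n m)
    num  = numerator q (λ i → tail (x i)) m G
    den′ = denominator q (tail t) G

  cTerm-cong : ∀ q t (x : Fin r → Fin (suc q) → Carrier) {n n′ N N′} → n ≗ n′ → N ≗ N′ →
               cTerm q t x n N ≡ cTerm q t x n′ N′
  cTerm-cong q t x n≗n′ N≗N′ = P.cong₂ (λ a b → a * b ⁻¹)
    (prodF-≗ (λ i → P.cong₂ (rowTerm (x i)) (n≗n′ i) (N≗N′ i)))
    (prodF-≗ (λ j → P.cong₂ (den (t j)) (sumℕ-cong (λ i → P.cong (λ v → lookup v (inject₁ j)) (N≗N′ i)))
                                         (sumℕ-cong (λ i → P.cong (λ v → lookup (diffs v) (inject₁ j)) (N≗N′ i)))))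

  sumList-map : ∀ {A : Set} (L : List A) f → sumList (map f L) ≡ ∑ L f
  sumList-map []      f = P.refl
  sumList-map (a ∷ L) f = P.cong (f a +_) (sumList-map L f)

  c-cong : ∀ q t (x : Fin r → Fin (suc q) → Carrier) {n n′} → n ≗ n′ → c q t x n ≈ c q t x n′
  c-cong q t x {n} {n′} n≗n′ = begin
    c q t x n                              ≡⟨ sumList-map (families q _ n) _ ⟩
    ∑ (families q _ n) (cTerm q t x n)     ≡⟨ P.cong (λ L → ∑ L (cTerm q t x n)) (families-cong n≗n′) ⟩
    ∑ (families q _ n′) (cTerm q t x n)    ≈⟨ ∑-cong (families q _ n′) (λ N →
                                                  reflexive (cTerm-cong q t x {N = N} n≗n′ (λ _ → P.refl))) ⟩
    ∑ (families q _ n′) (cTerm q t x n′)   ≡⟨ sumList-map (families q _ n′) _ ⟨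
    c q t x n′                             ∎

  module Recurrence {r} q (x : Fin r → Fin (suc (suc q)) → Carrier) (t : Fin (suc q) → Carrier)
                    (t∉ℤ≤0 : ∀ j → NotNonPosInt (t j)) where

    c⁺ c⁻ : (Fin r → ℕ) → Carrier
    c⁺ = c (suc q) t x
    c⁻ = c q (tail t) (λ i → tail (x i))

    y : Fin r → Carrier
    y i = x i zero

    weight : (Fin r → ℕ) → Carrier
    weight n = ι (sumℕ n) + t zero

    coeff : (n m : Fin r → ℕ) → Carrier
    coeff = layerCoeff (t zero) y

    -- Splits on n k exactly as shiftTerm does, so that one `with n k` unfolds both.
    shiftCoeff : (n m : Fin r → ℕ) → Fin r → Carrier
    shiftCoeff n m k with n k
    ... | zero  = 0#
    ... | suc a = y k * ι (suc a) * coeff (updateAt n k (λ _ → a)) m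

    c⁺-expand : ∀ n → c⁺ n ≈ ∑[ m ← boxes r n ] coeff n m * c⁻ m
    c⁺-expand n = begin
      c⁺ n
        ≡⟨ sumList-map (families (suc q) r n) _ ⟩
      ∑ (families (suc q) r n) (cTerm (suc q) t x n)
        ≈⟨ ∑-families-suc r n _ (λ N≗N′ → reflexive (cTerm-cong (suc q) t x {n} {n} (λ _ → P.refl) N≗N′)) ⟩
      ∑[ m ← boxes r n ] ∑[ G ← families q r m ] cTerm (suc q) t x n (λ i → n i ∷ G i)
        ≈⟨ ∑-cong-∈ (boxes r n) (λ m m∈ → ∑-cong-∈ (families q r m) (λ G G∈ →
             cTerm-∷ q t x t∉ℤ≤0 (∈-boxes⁻ m∈) (∈-families⁻ G∈))) ⟩
      ∑[ m ← boxes r n ] ∑[ G ← families q r m ] coeff n m * cTerm q (tail t) (λ i → tail (x i)) m G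
        ≈⟨ ∑-cong (boxes r n) (λ m → trans (sym (∑-*ˡ (families q r m) (coeff n m) _))
                                            (*-congˡ (reflexive (P.sym (sumList-map (families q r m) _))))) ⟩
      ∑[ m ← boxes r n ] coeff n m * c⁻ m ∎

    -- As a C b = 0 for b > a, coefficients outside the box vanish; this lets shifted sums be
    -- re-indexed over the unshifted box.
    coeff-vanishes : ∀ {n m} k → n k < m k → coeff n m ≈ 0#
    coeff-vanishes {n} {m} k nₖ<mₖ = trans (*-congʳ (prodF-zero _ k
      (trans (*-congʳ (reflexive (P.cong ι (k>n⇒nCk≡0 nₖ<mₖ)))) (zeroˡ _)))) (zeroˡ _)

    shiftTerm-expand : ∀ n k → shiftTerm (suc q) t x n k ≈ ∑[ m ← boxes r n ] shiftCoeff n m k * c⁻ m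
    shiftTerm-expand n k with n k in nₖ≡
    ... | zero  = sym (trans (∑-cong (boxes r n) (λ m → zeroˡ (c⁻ m))) (∑-zero (boxes r n)))
    ... | suc a = begin
      y k * ι (suc a) * c⁺ n′
        ≈⟨ *-congˡ (c⁺-expand n′) ⟩
      y k * ι (suc a) * (∑[ m ← boxes r n′ ] coeff n′ m * c⁻ m)
        ≈⟨ ∑-*ˡ (boxes r n′) _ _ ⟩
      ∑[ m ← boxes r n′ ] y k * ι (suc a) * (coeff n′ m * c⁻ m)
        ≈⟨ ∑-boxes-updateAt n k nₖ≡ _ (λ m mₖ≡1+a → trans (*-congˡ (trans (*-congʳ (coeff-vanishes {m = m} k
             (P.subst₂ _<_ (P.sym (updateAt-updates k n)) (P.sym mₖ≡1+a) (ℕP.n<1+n a)))) (zeroˡ _))) (zeroʳ _)) ⟩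
      ∑[ m ← boxes r n ] y k * ι (suc a) * (coeff n′ m * c⁻ m)
        ≈⟨ ∑-cong (boxes r n) (λ m → sym (*-assoc _ _ _)) ⟩
      ∑[ m ← boxes r n ] (y k * ι (suc a) * coeff n′ m) * c⁻ m ∎
      where n′ = updateAt n k (λ _ → a)

    corner-identity : ∀ {n m} → m ≗ n → weight n * coeff n m - sumF (shiftCoeff n m) ≈ 1#
    corner-identity {n} {m} m≗n = x≈z+y⇒x-y≈z (begin
      weight n * (leading y n m * den (t zero) (sumℕ n) (gap n m) ⁻¹)
        ≈⟨ *-congˡ (*-cong (prodF-one leading≈1) (⁻¹-cong (den-≉0 (t∉ℤ≤0 zero) (gap≤sumℕ n m)) den≈weight)) ⟩
      weight n * (1# * weight n ⁻¹)
        ≈⟨ trans (*-congˡ (*-identityˡ _)) (⁻¹-inverse _ weight≉0) ⟩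
      1#
        ≈⟨ +-identityʳ 1# ⟨
      1# + 0#
        ≈⟨ +-congˡ (sumF-zero shiftCoeff≈0) ⟨
      1# + sumF (shiftCoeff n m) ∎)
      where
      weight≉0 : weight n ≉ 0#
      weight≉0 = t∉ℤ≤0 zero (sumℕ n) ∘ trans (+-comm (t zero) _)
      leading≈1 : ∀ i → ι (n i C m i) * y i ^ (n i ℕ.∸ m i) ≈ 1#
      leading≈1 i rewrite m≗n i | nCn≡1 (n i) | ℕP.n∸n≡0 (n i) = trans (*-identityʳ _) (+-identityʳ 1#)
      den≈weight : den (t zero) (sumℕ n) (gap n m) ≈ weight n
      den≈weight rewrite sumℕ-zero (λ i → n i ℕ.∸ m i) (λ i → P.trans (P.cong (n i ℕ.∸_) (m≗n i)) (ℕP.n∸n≡0 (n i)))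
        = den-zero (t zero) (sumℕ n)
      shiftCoeff≈0 : ∀ k → shiftCoeff n m k ≈ 0#
      shiftCoeff≈0 k with n k in nₖ≡
      ... | zero  = refl
      ... | suc a = trans (*-congˡ (coeff-vanishes {m = m} k
                      (P.subst₂ _<_ (P.sym (updateAt-updates k n)) (P.sym (P.trans (m≗n k) nₖ≡)) (ℕP.n<1+n a)))) (zeroʳ _)

    module _ {n m : Fin r → ℕ} {N v} (Σn≡1+N : sumℕ n ≡ suc N) (gap≡1+v : gap n m ≡ suc v) where

      private
        E : Carrier
        E = den (t zero) N v
        E≉0 : E ≉ 0#
        E≉0 = den-≉0 (t∉ℤ≤0 zero) (ℕP.≤-pred (P.subst₂ _≤_ gap≡1+v Σn≡1+N (gap≤sumℕ n m)))

      shiftCoeff-interior : ∀ k → shiftCoeff n m k ≈ ι (n k ℕ.∸ m k) * (leading y n m * E ⁻¹)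
      shiftCoeff-interior k with n k in nₖ≡ | m k ℕ.≤? ℕ.pred (n k)
      ... | zero  | _ = sym (trans (*-congʳ (reflexive (P.cong ι (ℕP.0∸n≡0 (m k))))) (zeroˡ _))
      ... | suc a | no mₖ≰a = begin
        y k * ι (suc a) * coeff (updateAt n k (λ _ → a)) m
          ≈⟨ *-congˡ (coeff-vanishes {m = m} k (P.subst (_< m k) (P.sym (updateAt-updates k n)) (ℕP.≰⇒> mₖ≰a))) ⟩
        y k * ι (suc a) * 0#
          ≈⟨ trans (zeroʳ _) (sym (zeroˡ _)) ⟩
        0# * (leading y n m * E ⁻¹)
          ≡⟨ P.cong (λ d → ι d * (leading y n m * E ⁻¹)) (ℕP.m≤n⇒m∸n≡0 (ℕP.≰⇒> mₖ≰a)) ⟨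
        ι (suc a ℕ.∸ m k) * (leading y n m * E ⁻¹) ∎
      ... | suc a | yes mₖ≤a = begin
        y k * ι (suc a) * (leading y n′ m * den (t zero) (sumℕ n′) (gap n′ m) ⁻¹)
          ≡⟨ P.cong₂ (λ S V → y k * ι (suc a) * (leading y n′ m * den (t zero) S V ⁻¹))
                     (ℕP.suc-injective (P.trans (P.sym (sumℕ-updateAt-pred n k nₖ≡)) Σn≡1+N))
                     (ℕP.suc-injective (P.trans (P.sym (gap-updateAt-pred n m k nₖ≡ mₖ≤a)) gap≡1+v)) ⟩
        y k * ι (suc a) * (leading y n′ m * E ⁻¹)
          ≈⟨ sym (*-assoc _ _ _) ⟩
        (y k * ι (suc a) * leading y n′ m) * E ⁻¹
          ≈⟨ *-congʳ (prodF-scale-at _ _ k off-k at-k) ⟩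
        (ι (suc a ℕ.∸ m k) * leading y n m) * E ⁻¹
          ≈⟨ *-assoc _ _ _ ⟩
        ι (suc a ℕ.∸ m k) * (leading y n m * E ⁻¹) ∎
        where
        n′ = updateAt n k (λ _ → a)
        off-k : ∀ i → i P.≢ k → ι (n′ i C m i) * y i ^ (n′ i ℕ.∸ m i) ≈ ι (n i C m i) * y i ^ (n i ℕ.∸ m i)
        off-k i i≢k = reflexive (P.cong (λ b → ι (b C m i) * y i ^ (b ℕ.∸ m i)) (updateAt-minimal i k n i≢k))
        at-k : y k * ι (suc a) * (ι (n′ k C m k) * y k ^ (n′ k ℕ.∸ m k))
               ≈ ι (suc a ℕ.∸ m k) * (ι (n k C m k) * y k ^ (n k ℕ.∸ m k))
        at-k = begin
          y k * ι (suc a) * (ι (n′ k C m k) * y k ^ (n′ k ℕ.∸ m k))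
            ≡⟨ P.cong (λ b → y k * ι (suc a) * (ι (b C m k) * y k ^ (b ℕ.∸ m k))) (updateAt-updates k n) ⟩
          y k * ι (suc a) * (ι (a C m k) * y k ^ (a ℕ.∸ m k))
            ≈⟨ binomialTerm-absorb (y k) mₖ≤a ⟩
          ι (suc a ℕ.∸ m k) * (ι (suc a C m k) * y k ^ (suc a ℕ.∸ m k))
            ≡⟨ P.cong (λ b → ι (suc a ℕ.∸ m k) * (ι (b C m k) * y k ^ (b ℕ.∸ m k))) nₖ≡ ⟨
          ι (suc a ℕ.∸ m k) * (ι (n k C m k) * y k ^ (n k ℕ.∸ m k)) ∎

      weight*coeff : weight n * coeff n m ≈ ι (gap n m) * (leading y n m * E ⁻¹)
      weight*coeff = begin
        weight n * (L * D ⁻¹)        ≈⟨ *-assoc _ _ _ ⟨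
        (weight n * L) * D ⁻¹        ≈⟨ cross-multiply (den-≉0 (t∉ℤ≤0 zero) (gap≤sumℕ n m)) E≉0 cross ⟩
        (ι (gap n m) * L) * E ⁻¹     ≈⟨ *-assoc _ _ _ ⟩
        ι (gap n m) * (L * E ⁻¹)     ∎
        where
        L = leading y n m
        D = den (t zero) (sumℕ n) (gap n m)
        swap : ∀ a b c → (a * b) * c ≈ (a * c) * b
        swap = solve 3 (λ a b c → (a :* b) :* c := (a :* c) :* b) refl
        cross : (weight n * L) * E ≈ (ι (gap n m) * L) * D
        cross = trans (swap _ _ _) (trans (*-congʳ (den-suc (t zero) N v Σn≡1+N gap≡1+v)) (swap _ _ _))

      sumF-shiftCoeff : sumF (shiftCoeff n m) ≈ ι (gap n m) * (leading y n m * E ⁻¹)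
      sumF-shiftCoeff = begin
        sumF (shiftCoeff n m)                                          ≈⟨ sumF-cong shiftCoeff-interior ⟩
        sumF (λ k → ι (n k ℕ.∸ m k) * (leading y n m * E ⁻¹))          ≈⟨ sumF-*ʳ (λ k → ι (n k ℕ.∸ m k)) _ ⟨
        sumF (λ k → ι (n k ℕ.∸ m k)) * (leading y n m * E ⁻¹)          ≈⟨ *-congʳ (sumF-ι (λ k → n k ℕ.∸ m k)) ⟩
        ι (gap n m) * (leading y n m * E ⁻¹)                           ∎

    interior-identity : ∀ {n m} → Pointwise _≤_ m n → ¬ m ≗ n → weight n * coeff n m - sumF (shiftCoeff n m) ≈ 0#
    interior-identity {n} {m} m≤n m≢n =
      x≈z+y⇒x-y≈z (trans (weight*coeff {m = m} Σn≡1+N gap≡1+v)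
                         (sym (trans (+-identityˡ _) (sumF-shiftCoeff {m = m} Σn≡1+N gap≡1+v))))
      where
      0<gap : 0 < gap n m
      0<gap with FinP.¬∀⟶∃¬ r (λ i → m i ≡ n i) (λ i → m i ℕ.≟ n i) m≢n
      ... | k , mₖ≢nₖ = ℕP.<-≤-trans (ℕP.m<n⇒0<n∸m (ℕP.≤∧≢⇒< (m≤n k) mₖ≢nₖ)) (f≤sumℕf _ k)
      instance
        _ = ℕ.>-nonZero 0<gap
        _ = ℕ.>-nonZero (ℕP.<-≤-trans 0<gap (gap≤sumℕ n m))
      Σn≡1+N : sumℕ n ≡ suc (ℕ.pred (sumℕ n))
      Σn≡1+N = P.sym (ℕP.suc-pred (sumℕ n))
      gap≡1+v : gap n m ≡ suc (ℕ.pred (gap n m))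
      gap≡1+v = P.sym (ℕP.suc-pred (gap n m))

    recurrence : ∀ n → weight n * c⁺ n - sumF (shiftTerm (suc q) t x n) ≈ c⁻ n
    recurrence n = begin
      weight n * c⁺ n - sumF (shiftTerm (suc q) t x n)
        ≈⟨ +-cong (*-congˡ (c⁺-expand n)) (-‿cong (sumF-cong (shiftTerm-expand n))) ⟩
      weight n * (∑[ m ← B ] coeff n m * c⁻ m) - sumF (λ k → ∑[ m ← B ] shiftCoeff n m k * c⁻ m)
        ≈⟨ +-cong (∑-*ˡ B (weight n) _) (-‿cong (sumF-∑ B (λ k m → shiftCoeff n m k * c⁻ m))) ⟩
      (∑[ m ← B ] weight n * (coeff n m * c⁻ m)) - (∑[ m ← B ] sumF (λ k → shiftCoeff n m k * c⁻ m))
        ≈⟨ ∑-sub B _ _ ⟩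
      (∑[ m ← B ] weight n * (coeff n m * c⁻ m) - sumF (λ k → shiftCoeff n m k * c⁻ m))
        ≈⟨ ∑-cong B factor-c⁻ ⟩
      (∑[ m ← B ] (weight n * coeff n m - sumF (shiftCoeff n m)) * c⁻ m)
        ≈⟨ ∑-boxes-corner n _ at-corner elsewhere ⟩
      c⁻ n ∎
      where
      B = boxes r n
      factor-c⁻ : ∀ m → weight n * (coeff n m * c⁻ m) - sumF (λ k → shiftCoeff n m k * c⁻ m)
                        ≈ (weight n * coeff n m - sumF (shiftCoeff n m)) * c⁻ m
      factor-c⁻ m = sym (trans ([y-z]x≈yx-zx (c⁻ m) _ _)
                               (+-cong (*-assoc _ _ _) (-‿cong (sumF-*ʳ (shiftCoeff n m) (c⁻ m)))))
      at-corner : ∀ m → m ≗ n → (weight n * coeff n m - sumF (shiftCoeff n m)) * c⁻ m ≈ c⁻ n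
      at-corner m m≗n = trans (*-congʳ (corner-identity m≗n))
                              (trans (*-identityˡ _) (c-cong q (tail t) (λ i → tail (x i)) m≗n))
      elsewhere : ∀ m → Pointwise _≤_ m n → ¬ m ≗ n → (weight n * coeff n m - sumF (shiftCoeff n m)) * c⁻ m ≈ 0#
      elsewhere m m≤n m≢n = trans (*-congʳ (interior-identity m≤n m≢n)) (zeroˡ _)

-- The recurrence also holds for r = 0.
proposition3p3 : ∀ {a ℓ : Level} (F : CharZeroField a ℓ) →
    let open CharZeroField F in
    (r q : ℕ) → 1 ≤ r →
    (x : Fin r → Fin (suc (suc q)) → Carrier) →
    (t : Fin (suc q) → Carrier) →
    (∀ j → NotNonPosInt (t j)) →
    (n : Fin r → ℕ) →
    (ι (sumℕ n) + t zero) * c (suc q) t x n - sumF (shiftTerm (suc q) t x n)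
    ≈ c q (tail t) (λ i → tail (x i)) n
proposition3p3 F r q _ x t t∉ℤ≤0 = Recurrence.recurrence F q x t t∉ℤ≤0
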